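{- Let $T$ be a rooted binary tree properly coloured by colours in $[k]$. Let $v$ be a vertex of $T$ with two sons $s, t$, and let $c$ be the colour of $v$. Then $g_c(T_v) = g_c(T_t) + g_c(T_s) + 1$.
   Context: A rooted binary tree is a rooted tree in which every vertex has at most two children (sons). "Properly coloured" means coloured by a parity vertex colouring: every non-empty simple path contains some colour an odd number of times. For a vertex $u$ of a rooted tree $T$, $T_u$ is the subtree rooted at $u$ consisting of $u$ and all its descendants. A subtree $T'$ of a rooted tree $T$ is a compatible subtree if it is rooted at the vertex of $T'$ closest to the root of $T$. A vertex is branched if it has at least two children. A nicely coloured tree is a properly coloured rooted binary tree whose root, branched vertices and leaves all have one common colour $c$ (its nice colour); its nicely coloured vertices are those of colour $c$. For $i\in[k]$, $g_i(T)$ is the maximum number of nicely coloured vertices of a compatible subtree of $T$ which (with the inherited colouring and rooting) is a nicely coloured tree with nice colour $i$; it is $0$ if no such subtree exists. -}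

module Defs where

open import Data.Nat using (ℕ; zero; suc; _+_; _≤_; _%_)
open import Data.Fin using (Fin; _≟_)
open import Data.List using (List; []; _∷_; [_]; _++_; filter; length)
open import Data.Product using (Σ; ∃; _×_; _,_)
open import Data.Sum using (_⊎_)
open import Relation.Nullary using (¬_; yes; no)
open import Relation.Binary.PropositionalEquality using (_≡_)

-- The order of the two sons of a
-- binary vertex carries no meaning for any notion below.
data Tree (k : ℕ) : Set where
  leaf   : Fin k → Tree k
  unary  : Fin k → Tree k → Tree k
  binary : Fin k → Tree k → Tree k → Tree k

module _ {k : ℕ} where

  rootColour : Tree k → Fin k
  rootColour (leaf c)       = c
  rootColour (unary c _)    = c
  rootColour (binary c _ _) = c

  -- Sub u T : u is T_x for some vertex x of T (the subtree rooted at x).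
  data Sub : Tree k → Tree k → Set where
    here  : ∀ {t} → Sub t t
    inU   : ∀ {u c t} → Sub u t → Sub u (unary c t)
    inL   : ∀ {u c l r} → Sub u l → Sub u (binary c l r)
    inR   : ∀ {u c l r} → Sub u r → Sub u (binary c l r)

  -- Prune P u : P is a subtree of u containing the root of u, rooted at the
  -- root of u (i.e. u with some descendant-closed set of non-root vertices
  -- removed), with the inherited colouring.
  data Prune : Tree k → Tree k → Set where
    cutU  : ∀ {c t} → Prune (leaf c) (unary c t)
    cutB  : ∀ {c l r} → Prune (leaf c) (binary c l r)
    keepL : ∀ {c} → Prune (leaf c) (leaf c)
    keepU : ∀ {c p t} → Prune p t → Prune (unary c p) (unary c t)
    keepL₁ : ∀ {c p l r} → Prune p l → Prune (unary c p) (binary c l r)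
    keepR₁ : ∀ {c q l r} → Prune q r → Prune (unary c q) (binary c l r)
    keepB : ∀ {c p q l r} → Prune p l → Prune q r → Prune (binary c p q) (binary c l r)

  -- Compatible subtree P of T: a subtree of T, rooted at its vertex closest to
  -- the root of T.  Such a subtree is exactly a pruning of some T_u.
  Compatible : Tree k → Tree k → Set
  Compatible P T = ∃ λ u → Sub u T × Prune P u

  -- Down t xs : xs is the list of colours along a descending path starting at
  -- the root of t (root included).
  data Down : Tree k → List (Fin k) → Set where
    stop  : ∀ {t} → Down t [ rootColour t ]
    stepU : ∀ {c t xs} → Down t xs → Down (unary c t) (c ∷ xs)
    stepL : ∀ {c l r xs} → Down l xs → Down (binary c l r) (c ∷ xs)
    stepR : ∀ {c l r xs} → Down r xs → Down (binary c l r) (c ∷ xs)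

  -- TopPath t cs : cs is the multiset (as a list) of colours of a non-empty
  -- simple path in t whose highest vertex is the root of t.
  data TopPath : Tree k → List (Fin k) → Set where
    oneSided : ∀ {t xs} → Down t xs → TopPath t xs
    twoSided : ∀ {c l r xs ys} → Down l xs → Down r ys →
               TopPath (binary c l r) (c ∷ xs ++ ys)

  count : Fin k → List (Fin k) → ℕ
  count i cs = length (filter (λ j → j ≟ i) cs)

  -- Parity vertex colouring: every non-empty simple path contains some colour
  -- an odd number of times.  (Every simple path in a rooted tree has a unique
  -- highest vertex u and is a TopPath of T_u.)
  Proper : Tree k → Set
  Proper T = ∀ u cs → Sub u T → TopPath u cs → ∃ λ (i : Fin k) → count i cs % 2 ≡ 1

  data LeavesBranched (i : Fin k) : Tree k → Set where
    lf : LeavesBranched i (leaf i)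
    un : ∀ {c t} → LeavesBranched i t → LeavesBranched i (unary c t)
    bi : ∀ {l r} → LeavesBranched i l → LeavesBranched i r →
         LeavesBranched i (binary i l r)

  Nice : Fin k → Tree k → Set
  Nice i P = Proper P × rootColour P ≡ i × LeavesBranched i P

  countCol : Fin k → Tree k → ℕ
  countCol i (leaf c)       with c ≟ i
  ... | yes _ = 1
  ... | no  _ = 0
  countCol i (unary c t)    with c ≟ i
  ... | yes _ = suc (countCol i t)
  ... | no  _ = countCol i t
  countCol i (binary c l r) with c ≟ i
  ... | yes _ = suc (countCol i l + countCol i r)
  ... | no  _ = countCol i l + countCol i r

  -- IsG i T m : m = g_i(T), i.e. m is the maximum number of nicely coloured
  -- vertices of a compatible subtree of T that is nicely coloured with nice
  -- colour i, and m = 0 if no such subtree exists.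
  IsG : Fin k → Tree k → ℕ → Set
  IsG i T m =
    (∀ P → Compatible P T → Nice i P → countCol i P ≤ m) ×
    (m ≡ 0 ⊎ (∃ λ P → Compatible P T × Nice i P × countCol i P ≡ m))

module Submission where

-- Write v = binary c s t.  A compatible subtree of T_v either lies
-- inside T_s or T_t, or is a pruning of T_v itself (it contains v).  So it
-- suffices to understand the largest number of c-coloured vertices in a
-- pruning P of a tree u whose leaves and branched vertices are coloured c
-- (a "c-skeleton" of u; its root need not be coloured c):
--   * such a P has at most g_c(u) vertices of colour c: strip the vertices
--     above the first c-coloured one (they are unary and not coloured c) and
--     what remains is a nicely coloured compatible subtree of u, properly
--     coloured because parity colourings pass to compatible subtrees;
--   * conversely an optimal nicely coloured compatible subtree of u extends
--     upwards, through unary vertices, to a c-skeleton of u itself.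
-- Hence g_c(u) is the maximum size of a c-skeleton of u (or 0).  Skeletons of
-- T_v are exactly v on top of an optional skeleton of T_s and an optional
-- skeleton of T_t, and v has colour c; this gives g_c(T_v) = g_c(T_s) + g_c(T_t) + 1.

open import Defs
open import Data.Nat using (ℕ; suc; _+_; _≤_; z≤n; s≤s)
open import Data.Nat.Properties
  using (≤-refl; ≤-trans; ≤-reflexive; ≤-antisym; n≤1+n; m≤m+n; m≤n+m; +-mono-≤; +-comm; +-identityʳ)
open import Data.Fin using (Fin; _≟_)
open import Data.List using ([_])
open import Data.Product using (∃; _×_; _,_; proj₁; proj₂)
open import Data.Sum using (_⊎_; inj₁; inj₂)
open import Data.Empty using (⊥-elim)
open import Relation.Nullary using (¬_; yes; no)
open import Relation.Binary.PropositionalEquality using (_≡_; refl; sym; trans; cong; subst)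

module _ {k : ℕ} where

  Sub-trans : ∀ {a b c : Tree k} → Sub a b → Sub b c → Sub a c
  Sub-trans ab here     = ab
  Sub-trans ab (inU bc) = inU (Sub-trans ab bc)
  Sub-trans ab (inL bc) = inL (Sub-trans ab bc)
  Sub-trans ab (inR bc) = inR (Sub-trans ab bc)

  Prune-rootColour : ∀ {p t : Tree k} → Prune p t → rootColour p ≡ rootColour t
  Prune-rootColour cutU        = refl
  Prune-rootColour cutB        = refl
  Prune-rootColour keepL       = refl
  Prune-rootColour (keepU _)   = refl
  Prune-rootColour (keepL₁ _)  = refl
  Prune-rootColour (keepR₁ _)  = refl
  Prune-rootColour (keepB _ _) = refl

  Prune-Down : ∀ {p t : Tree k} {xs} → Prune p t → Down p xs → Down t xs
  Prune-Down {t = t} pr stop   = subst (λ x → Down t [ x ]) (sym (Prune-rootColour pr)) stop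
  Prune-Down (keepU pr) (stepU d)    = stepU (Prune-Down pr d)
  Prune-Down (keepL₁ pr) (stepU d)   = stepL (Prune-Down pr d)
  Prune-Down (keepR₁ pr) (stepU d)   = stepR (Prune-Down pr d)
  Prune-Down (keepB pl _) (stepL d)  = stepL (Prune-Down pl d)
  Prune-Down (keepB _ pr) (stepR d)  = stepR (Prune-Down pr d)

  Prune-TopPath : ∀ {p t : Tree k} {cs} → Prune p t → TopPath p cs → TopPath t cs
  Prune-TopPath pr (oneSided d)                   = oneSided (Prune-Down pr d)
  Prune-TopPath (keepB pl pr) (twoSided dl dr) = twoSided (Prune-Down pl dl) (Prune-Down pr dr)

  Prune-Sub : ∀ {P u x : Tree k} → Prune P u → Sub x P → ∃ λ y → Sub y u × Prune x y
  Prune-Sub pr here = _ , here , pr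
  Prune-Sub (keepU pr) (inU sb) with Prune-Sub pr sb
  ... | y , sy , py = y , inU sy , py
  Prune-Sub (keepL₁ pr) (inU sb) with Prune-Sub pr sb
  ... | y , sy , py = y , inL sy , py
  Prune-Sub (keepR₁ pr) (inU sb) with Prune-Sub pr sb
  ... | y , sy , py = y , inR sy , py
  Prune-Sub (keepB pl _) (inL sb) with Prune-Sub pl sb
  ... | y , sy , py = y , inL sy , py
  Prune-Sub (keepB _ pr) (inR sb) with Prune-Sub pr sb
  ... | y , sy , py = y , inR sy , py

  Proper-Sub : ∀ {T u : Tree k} → Proper T → Sub u T → Proper u
  Proper-Sub prT sb x cs sx tp = prT x cs (Sub-trans sx sb) tp

  Proper-compatible : ∀ {T P : Tree k} → Proper T → Compatible P T → Proper P
  Proper-compatible prT (u , sb , pr) x cs sx tp with Prune-Sub pr sx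
  ... | y , sy , py = prT y cs (Sub-trans sy sb) (Prune-TopPath py tp)

  countCol-leaf-self : (c : Fin k) → countCol c (leaf c) ≡ 1
  countCol-leaf-self c with c ≟ c
  ... | yes _ = refl
  ... | no c≢c = ⊥-elim (c≢c refl)

  countCol-unary-self : (c : Fin k) (p : Tree k) → countCol c (unary c p) ≡ suc (countCol c p)
  countCol-unary-self c p with c ≟ c
  ... | yes _ = refl
  ... | no c≢c = ⊥-elim (c≢c refl)

  countCol-binary-self : (c : Fin k) (p q : Tree k) →
                         countCol c (binary c p q) ≡ suc (countCol c p + countCol c q)
  countCol-binary-self c p q with c ≟ c
  ... | yes _ = refl
  ... | no c≢c = ⊥-elim (c≢c refl)

  countCol-unary-other : (c c' : Fin k) (p : Tree k) → ¬ c' ≡ c →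
                         countCol c (unary c' p) ≡ countCol c p
  countCol-unary-other c c' p c'≢c with c' ≟ c
  ... | yes c'≡c = ⊥-elim (c'≢c c'≡c)
  ... | no _ = refl

  countCol-unary-≤ : (c c' : Fin k) (p : Tree k) → countCol c p ≤ countCol c (unary c' p)
  countCol-unary-≤ c c' p with c' ≟ c
  ... | yes _ = n≤1+n _
  ... | no _ = ≤-refl

  -- A c-skeleton of u is a pruning of u whose leaves and branched vertices have
  -- colour c.
  SkeletonBound : Fin k → Tree k → ℕ → Set
  SkeletonBound c u g = ∀ p → Prune p u → LeavesBranched c p → countCol c p ≤ g

  SkeletonAttained : Fin k → Tree k → ℕ → Set
  SkeletonAttained c u g =
    g ≡ 0 ⊎ (∃ λ p → Prune p u × LeavesBranched c p × g ≤ countCol c p)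

  -- Above its first c-coloured vertex a skeleton is a chain of
  -- unary vertices of other colours, which contribute nothing to the count.
  skeleton-bound : ∀ {c : Fin k} {s : Tree k} {g : ℕ} → Proper s →
                   (∀ P → Compatible P s → Nice c P → countCol c P ≤ g) →
                   ∀ {u p} → Sub u s → Prune p u → LeavesBranched c p → countCol c p ≤ g
  skeleton-bound {c} prS bound {u} {p} sb pr lb with rootColour p ≟ c
  ... | yes root≡c = bound p (u , sb , pr) (Proper-compatible prS (u , sb , pr) , root≡c , lb)
  skeleton-bound prS bound sb pr lf       | no root≢c = ⊥-elim (root≢c refl)
  skeleton-bound prS bound sb pr (bi _ _) | no root≢c = ⊥-elim (root≢c refl)
  skeleton-bound {c} prS bound sb (keepU pr) (un {c'} {p'} lb) | no c'≢c =
    ≤-trans (≤-reflexive (countCol-unary-other c c' p' c'≢c))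
      (skeleton-bound prS bound (Sub-trans (inU here) sb) pr lb)
  skeleton-bound {c} prS bound sb (keepL₁ pr) (un {c'} {p'} lb) | no c'≢c =
    ≤-trans (≤-reflexive (countCol-unary-other c c' p' c'≢c))
      (skeleton-bound prS bound (Sub-trans (inL here) sb) pr lb)
  skeleton-bound {c} prS bound sb (keepR₁ pr) (un {c'} {p'} lb) | no c'≢c =
    ≤-trans (≤-reflexive (countCol-unary-other c c' p' c'≢c))
      (skeleton-bound prS bound (Sub-trans (inR here) sb) pr lb)

  lift-skeleton : ∀ {c : Fin k} {s u q : Tree k} → Sub u s → Prune q u → LeavesBranched c q →
                  ∃ λ p → Prune p s × LeavesBranched c p × countCol c q ≤ countCol c p
  lift-skeleton here pr lb = _ , pr , lb , ≤-refl
  lift-skeleton {c} {unary c' _} (inU sb) pr lb with lift-skeleton sb pr lb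
  ... | p , pp , lbp , le = unary c' p , keepU pp , un lbp , ≤-trans le (countCol-unary-≤ c c' p)
  lift-skeleton {c} {binary c' _ _} (inL sb) pr lb with lift-skeleton sb pr lb
  ... | p , pp , lbp , le = unary c' p , keepL₁ pp , un lbp , ≤-trans le (countCol-unary-≤ c c' p)
  lift-skeleton {c} {binary c' _ _} (inR sb) pr lb with lift-skeleton sb pr lb
  ... | p , pp , lbp , le = unary c' p , keepR₁ pp , un lbp , ≤-trans le (countCol-unary-≤ c c' p)

  IsG⇒SkeletonBound : ∀ {c : Fin k} {s : Tree k} {g : ℕ} → Proper s → IsG c s g →
                      SkeletonBound c s g
  IsG⇒SkeletonBound prS (bound , _) p pr lb = skeleton-bound prS bound here pr lb

  IsG⇒SkeletonAttained : ∀ {c : Fin k} {s : Tree k} {g : ℕ} → IsG c s g → SkeletonAttained c s g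
  IsG⇒SkeletonAttained (_ , inj₁ g≡0) = inj₁ g≡0
  IsG⇒SkeletonAttained (_ , inj₂ (Q , (u , sb , pr) , (_ , _ , lb) , Q≡g)) with lift-skeleton sb pr lb
  ... | p , pp , lbp , le = inj₂ (p , pp , lbp , subst (_≤ _) Q≡g le)

  -- A c-skeleton of binary c s t is the root on top of an optional c-skeleton of
  -- each son; the root adds one c-coloured vertex.
  binary-skeleton-bound : ∀ {c : Fin k} {s t : Tree k} {gs gt : ℕ} →
                          SkeletonBound c s gs → SkeletonBound c t gt →
                          SkeletonBound c (binary c s t) (suc (gs + gt))
  binary-skeleton-bound {c} _ _ _ cutB lf =
    ≤-trans (≤-reflexive (countCol-leaf-self c)) (s≤s z≤n)
  binary-skeleton-bound {c} {gs = gs} {gt} bs _ _ (keepL₁ {p = p} pr) (un lb) =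
    ≤-trans (≤-reflexive (countCol-unary-self c p)) (s≤s (≤-trans (bs p pr lb) (m≤m+n gs gt)))
  binary-skeleton-bound {c} {gs = gs} {gt} _ bt _ (keepR₁ {q = q} pr) (un lb) =
    ≤-trans (≤-reflexive (countCol-unary-self c q)) (s≤s (≤-trans (bt q pr lb) (m≤n+m gt gs)))
  binary-skeleton-bound {c} bs bt _ (keepB {p = p} {q = q} pl pr) (bi lbl lbr) =
    ≤-trans (≤-reflexive (countCol-binary-self c p q)) (s≤s (+-mono-≤ (bs p pl lbl) (bt q pr lbr)))

  binary-skeleton-attained : ∀ {c : Fin k} {s t : Tree k} {gs gt : ℕ} →
                             SkeletonAttained c s gs → SkeletonAttained c t gt →
                             ∃ λ P → Prune P (binary c s t) × LeavesBranched c P ×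
                                     suc (gs + gt) ≤ countCol c P
  binary-skeleton-attained {c} (inj₁ refl) (inj₁ refl) =
    leaf c , cutB , lf , ≤-reflexive (sym (countCol-leaf-self c))
  binary-skeleton-attained {c} {gs = gs} (inj₂ (p , pp , lbp , le)) (inj₁ refl) =
    unary c p , keepL₁ pp , un lbp ,
    ≤-trans (s≤s (≤-trans (≤-reflexive (+-identityʳ gs)) le))
            (≤-reflexive (sym (countCol-unary-self c p)))
  binary-skeleton-attained {c} (inj₁ refl) (inj₂ (q , pq , lbq , le)) =
    unary c q , keepR₁ pq , un lbq , ≤-trans (s≤s le) (≤-reflexive (sym (countCol-unary-self c q)))
  binary-skeleton-attained {c} (inj₂ (p , pp , lbp , lep)) (inj₂ (q , pq , lbq , leq)) =
    binary c p q , keepB pp pq , bi lbp lbq ,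
    ≤-trans (s≤s (+-mono-≤ lep leq)) (≤-reflexive (sym (countCol-binary-self c p q)))

  -- A compatible subtree of binary c s t lies in s, lies in t, or is a skeleton
  -- of the whole tree.
  binary-compatible-bound : ∀ {c : Fin k} {s t : Tree k} {gs gt : ℕ} → IsG c s gs → IsG c t gt →
                            SkeletonBound c (binary c s t) (suc (gs + gt)) →
                            ∀ P → Compatible P (binary c s t) → Nice c P →
                            countCol c P ≤ suc (gs + gt)
  binary-compatible-bound _ _ bv P (_ , here , pr) (_ , _ , lb) = bv P pr lb
  binary-compatible-bound {gs = gs} {gt} (bs , _) _ _ P (u , inL sb , pr) ni =
    ≤-trans (bs P (u , sb , pr) ni) (≤-trans (m≤m+n gs gt) (n≤1+n _))
  binary-compatible-bound {gs = gs} {gt} _ (bt , _) _ P (u , inR sb , pr) ni =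
    ≤-trans (bt P (u , sb , pr) ni) (≤-trans (m≤n+m gt gs) (n≤1+n _))

lemma8 : ∀ {k : ℕ} (T : Tree k) → Proper T →
         ∀ (c : Fin k) (s t : Tree k) → Sub (binary c s t) T →
         ∀ (gv gs gt : ℕ) → IsG c (binary c s t) gv → IsG c s gs → IsG c t gt →
         gv ≡ gt + gs + 1
lemma8 T prT c s t sb gv gs gt Gv Gs Gt =
  trans (≤-antisym upper lower) reorder
  where
  reorder : suc (gs + gt) ≡ gt + gs + 1
  reorder = trans (cong suc (+-comm gs gt)) (sym (+-comm (gt + gs) 1))

  prV : Proper (binary c s t)
  prV = Proper-Sub prT sb

  skeletonsV : SkeletonBound c (binary c s t) (suc (gs + gt))
  skeletonsV = binary-skeleton-bound (IsG⇒SkeletonBound (Proper-Sub prV (inL here)) Gs)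
                                     (IsG⇒SkeletonBound (Proper-Sub prV (inR here)) Gt)

  upper : gv ≤ suc (gs + gt)
  upper with proj₂ Gv
  ... | inj₁ refl = z≤n
  ... | inj₂ (P , cp , ni , refl) = binary-compatible-bound Gs Gt skeletonsV P cp ni

  lower : suc (gs + gt) ≤ gv
  lower with binary-skeleton-attained (IsG⇒SkeletonAttained Gs) (IsG⇒SkeletonAttained Gt)
  ... | P , pr , lb , le =
    ≤-trans le (proj₁ Gv P cp (Proper-compatible prV cp , Prune-rootColour pr , lb))
    where
    cp : Compatible P (binary c s t)
    cp = binary c s t , here , pr
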